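{- Let $I\subseteq\omega$ be finite. Then: (1) $\|[I]^2\|_I\to\infty$ as $|I|\to\infty$; (2) for $X,Y\subseteq[I]^2$, $\|X\cup Y\|_I\le\|X\|_I+\|Y\|_I$; (3) if $Z\subseteq I$, $X\subseteq[I]^2$ and $\|X\|_I>2$, then either $\|[Z]^2\cap X\|_I\ge \|X\|_I/2-1$ or $\|[I\setminus Z]^2\cap X\|_I\ge\|X\|_I/2-1$.
   Context: Let $\Delta=\{(n,n):n\in\omega\}$. For a finite set $I\subseteq\omega$, let $[I]^2=(I\times I)\setminus\Delta$ (a set of ordered pairs). For $X\subseteq[I]^2$ define $\|X\|_I=\min\{k : \text{there exist sets } A_i,B_i\ (i\le k) \text{ with } A_i\cap B_i=\emptyset \text{ for all } i\le k \text{ and } X\subseteq\bigcup_{i\le k}A_i\times B_i\}$. -}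

module Defs where

open import Level using (0ℓ)
open import Data.Nat using (ℕ; _≤_; _<_; _+_; _*_)
open import Data.Fin using (Fin)
open import Data.Product using (Σ; ∃; _×_; _,_)
open import Data.List using (List; length)
open import Data.List.Membership.Propositional using (_∈_)
open import Relation.Nullary using (¬_)
open import Relation.Unary using (Pred; _∪_; _∩_)
open import Relation.Binary.PropositionalEquality using (_≡_; _≢_)

-- A finite set I ⊆ ω is represented by a duplicate-free list of its
-- elements (duplicate-freeness is imposed where |I| matters).

Pairs : Set₁
Pairs = Pred (ℕ × ℕ) 0ℓ

Sq : List ℕ → Pairs
Sq I (m , n) = (m ∈ I) × (n ∈ I) × (m ≢ n)

SqP : Pred ℕ 0ℓ → Pairs
SqP Z (m , n) = Z m × Z n × (m ≢ n)

Diff : List ℕ → Pred ℕ 0ℓ → Pred ℕ 0ℓ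
Diff I Z n = (n ∈ I) × ¬ Z n

_⊆P_ : Pairs → Pairs → Set
X ⊆P Y = ∀ p → X p → Y p

Covers : Pairs → ℕ → Set₁
Covers X k =
  Σ (Fin k → Pred ℕ 0ℓ) λ A →
  Σ (Fin k → Pred ℕ 0ℓ) λ B →
    (∀ i n → A i n → B i n → Data.Empty.⊥) ×
    (∀ m n → X (m , n) → ∃ λ i → A i m × B i n)
  where import Data.Empty

-- ‖X‖_I = k : k is the least number of such rectangles covering X.
-- (The sets A_i, B_i are arbitrary subsets of ω; restricting them to I
-- gives the same value since X ⊆ [I]^2.)
NormIs : List ℕ → Pairs → ℕ → Set₁
NormIs I X k = Covers X k × (∀ j → Covers X j → k ≤ j)

-- A cover of [I]^2 by k rectangles A_i × B_i with A_i ∩ B_i = ∅ colours each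
-- pair (m , n) by a rectangle containing it, and then (m , n) and (n , p) get
-- different colours because n ∈ B_i ∩ A_j. Such a colouring of the shift graph
-- on I needs at least log₂ |I| colours: the heads of the pairs of colour 0, and
-- the remaining points, both span no pair of colour 0, so by induction each set
-- has at most 2^(k-1) points. Subadditivity is the union of two covers. For the
-- splitting, X is covered by [Z]^2 ∩ X, [I ∖ Z]^2 ∩ X and the two rectangles
-- Z × (I ∖ Z), (I ∖ Z) × Z, so ‖X‖ ≤ a + b + 2; membership in Z is decided only
-- under a double negation, which is harmless since the conclusion is decidable.
module Submission where

open import Defs
open import Level using (0ℓ)
open import Data.Nat using (ℕ; _≤_; _<_; _+_; _*_; _^_; zero; suc; pred; z≤n; s≤s; _≟_; _≤?_; ≢-nonZero)
open import Data.Nat.Properties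
open import Data.Nat.Tactic.RingSolver using (solve-∀)
open import Data.Fin using (Fin; toℕ; splitAt; _↑ˡ_; _↑ʳ_)
open import Data.Fin.Properties using (toℕ<n; toℕ-injective; splitAt-↑ˡ; splitAt-↑ʳ)
open import Data.Product using (∃; _×_; _,_; proj₁; proj₂)
open import Data.Sum using (_⊎_; inj₁; inj₂; [_,_]′)
open import Data.List using (List; length; []; _∷_; filter)
open import Data.List.Membership.Propositional using (_∈_; find; lose)
open import Data.List.Membership.Propositional.Properties using (∈-filter⁻)
open import Data.List.Membership.DecPropositional _≟_ using (_∈?_)
open import Data.List.Relation.Unary.Unique.Propositional using (Unique)
open import Data.List.Relation.Unary.Unique.Propositional.Properties using (filter⁺)
open import Data.List.Relation.Unary.Any using (Any; here; there; any?)
open import Data.List.Relation.Unary.All as All using (All; []; _∷_)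
open import Data.List.Relation.Unary.AllPairs using (_∷_)
open import Data.Empty using (⊥)
open import Relation.Nullary using (¬_; Dec; yes; no; ¬?; contradiction)
open import Relation.Nullary.Decidable using (_×-dec_; ¬¬-excluded-middle; decidable-stable)
open import Relation.Nullary.Negation using (¬¬-map)
open import Relation.Unary using (Pred; _∪_; _∩_; ∁; Decidable)
open import Relation.Unary.Properties using (∁?)
open import Relation.Binary.PropositionalEquality using (_≡_; _≢_; refl; sym; trans; cong; subst)

covers-∪ : ∀ {X X₁ X₂ : Pairs} {a b} → X ⊆P (X₁ ∪ X₂) →
           Covers X₁ a → Covers X₂ b → Covers X (a + b)
covers-∪ {X} {a = a} {b} X⊆X₁∪X₂ (A₁ , B₁ , disjoint₁ , covered₁) (A₂ , B₂ , disjoint₂ , covered₂) =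
  A , B , disjoint , covered
  where
  A B : Fin (a + b) → Pred ℕ 0ℓ
  A i = [ A₁ , A₂ ]′ (splitAt a i)
  B i = [ B₁ , B₂ ]′ (splitAt a i)

  disjoint : ∀ i n → A i n → B i n → ⊥
  disjoint i n with splitAt a i
  ... | inj₁ j = disjoint₁ j n
  ... | inj₂ j = disjoint₂ j n

  rectangle : ∀ {m n} i {j} → splitAt a i ≡ j →
              [ A₁ , A₂ ]′ j m → [ B₁ , B₂ ]′ j n → A i m × B i n
  rectangle i refl m∈A n∈B = m∈A , n∈B

  covered : ∀ m n → X (m , n) → ∃ λ i → A i m × B i n
  covered m n x with X⊆X₁∪X₂ (m , n) x
  ... | inj₁ x₁ = let i , m∈A , n∈B = covered₁ m n x₁ in
                  i ↑ˡ b , rectangle (i ↑ˡ b) (splitAt-↑ˡ a i b) m∈A n∈B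
  ... | inj₂ x₂ = let i , m∈A , n∈B = covered₂ m n x₂ in
                  a ↑ʳ i , rectangle (a ↑ʳ i) (splitAt-↑ʳ a b i) m∈A n∈B

Sq-mono : ∀ {L L′ : List ℕ} → (∀ {x} → x ∈ L′ → x ∈ L) → Sq L′ ⊆P Sq L
Sq-mono L′⊆L _ (m∈L′ , n∈L′ , m≢n) = L′⊆L m∈L′ , L′⊆L n∈L′ , m≢n

length-filter-+-filter-∁ : ∀ {a ℓ} {A : Set a} {P : Pred A ℓ} (P? : Decidable P) xs →
                           length (filter P? xs) + length (filter (∁? P?) xs) ≡ length xs
length-filter-+-filter-∁ P? [] = refl
length-filter-+-filter-∁ P? (x ∷ xs) with P? x
... | yes _ = cong suc (length-filter-+-filter-∁ P? xs)
... | no _ = trans (+-suc _ _) (cong suc (length-filter-+-filter-∁ P? xs))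

^-cancelʳ-≤ : ∀ b {m n} → 1 < b → b ^ m ≤ b ^ n → m ≤ n
^-cancelʳ-≤ b 1<b bᵐ≤bⁿ = ≮⇒≥ λ n<m → <⇒≱ (^-monoʳ-< b 1<b n<m) bᵐ≤bⁿ

ShiftColouring : ℕ → List ℕ → (ℕ → ℕ → ℕ) → Set
ShiftColouring k L c =
  (∀ {m n} → Sq L (m , n) → c m n < k) ×
  (∀ {m n p} → Sq L (m , n) → Sq L (n , p) → c m n ≢ c n p)

shiftColouring-pred : ∀ {k L L′ c} → ShiftColouring (suc k) L c →
                      (∀ {x} → x ∈ L′ → x ∈ L) →
                      (∀ {m n} → Sq L′ (m , n) → c m n ≢ 0) →
                      ShiftColouring k L′ (λ m n → pred (c m n))
shiftColouring-pred {c = c} (bounded , proper) L′⊆L nonzero =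
  (λ s → pred-mono-< {{≢-nonZero (nonzero s)}} (bounded (Sq-mono L′⊆L _ s))) ,
  (λ {m} {n} {p} s t e → proper (Sq-mono L′⊆L _ s) (Sq-mono L′⊆L _ t)
     (pred-injective {c m n} {c n p} {{≢-nonZero (nonzero s)}} {{≢-nonZero (nonzero t)}} e))

length≤2^colours : ∀ k L → Unique L → ∀ c → ShiftColouring k L c → length L ≤ 2 ^ k
length≤2^colours zero [] _ _ _ = z≤n
length≤2^colours zero (_ ∷ []) _ _ _ = s≤s z≤n
length≤2^colours zero (_ ∷ _ ∷ _) ((x≢y ∷ _) ∷ _) _ (bounded , _) =
  contradiction (bounded (here refl , there (here refl) , x≢y)) n≮0
length≤2^colours (suc k) L unique c χ@(_ , proper) = begin
  length L                   ≡⟨ sym (length-filter-+-filter-∁ head? L) ⟩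
  length Heads + length Rest ≤⟨ +-mono-≤ (length≤2^colours k Heads (filter⁺ head? unique) _ χ-Heads)
                                          (length≤2^colours k Rest (filter⁺ (∁? head?) unique) _ χ-Rest) ⟩
  2 ^ k + 2 ^ k              ≡⟨ cong (2 ^ k +_) (sym (+-identityʳ (2 ^ k))) ⟩
  2 ^ suc k                  ∎
  where
  open ≤-Reasoning

  Head : Pred ℕ 0ℓ
  Head n = Any (λ m → m ≢ n × c m n ≡ 0) L

  head? : Decidable Head
  head? n = any? (λ m → ¬? (m ≟ n) ×-dec (c m n ≟ 0)) L

  Heads Rest : List ℕ
  Heads = filter head? L
  Rest = filter (∁? head?) L

  χ-Heads : ShiftColouring k Heads (λ m n → pred (c m n))
  χ-Heads = shiftColouring-pred χ (λ x∈ → proj₁ (∈-filter⁻ head? {xs = L} x∈)) nonzero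
    where
    nonzero : ∀ {m n} → Sq Heads (m , n) → c m n ≢ 0
    nonzero (m∈ , n∈ , m≢n) cmn≡0 with ∈-filter⁻ head? {xs = L} m∈ | ∈-filter⁻ head? {xs = L} n∈
    ... | m∈L , m-head | n∈L , _ with find m-head
    ... | z , z∈L , z≢m , czm≡0 = proper (z∈L , m∈L , z≢m) (m∈L , n∈L , m≢n) (trans czm≡0 (sym cmn≡0))

  χ-Rest : ShiftColouring k Rest (λ m n → pred (c m n))
  χ-Rest = shiftColouring-pred χ (λ x∈ → proj₁ (∈-filter⁻ (∁? head?) {xs = L} x∈)) nonzero
    where
    nonzero : ∀ {m n} → Sq Rest (m , n) → c m n ≢ 0
    nonzero (m∈ , n∈ , m≢n) cmn≡0 with ∈-filter⁻ (∁? head?) {xs = L} m∈ | ∈-filter⁻ (∁? head?) {xs = L} n∈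
    ... | m∈L , _ | _ , n-not-head = n-not-head (lose m∈L (m≢n , cmn≡0))

covers⇒shiftColouring : ∀ {I k} → Covers (Sq I) k → ∃ (ShiftColouring k I)
covers⇒shiftColouring {I} {k} (A , B , disjoint , covered) = colour , bounded , proper
  where
  Sq? : ∀ m n → Dec (Sq I (m , n))
  Sq? m n = m ∈? I ×-dec n ∈? I ×-dec ¬? (m ≟ n)

  colour : ℕ → ℕ → ℕ
  colour m n with Sq? m n
  ... | yes s = toℕ (proj₁ (covered m n s))
  ... | no _ = 0

  colour-rectangle : ∀ {m n} → Sq I (m , n) → ∃ λ i → colour m n ≡ toℕ i × A i m × B i n
  colour-rectangle {m} {n} s with Sq? m n
  ... | yes s′ = proj₁ (covered m n s′) , refl , proj₂ (covered m n s′)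
  ... | no ¬s = contradiction s ¬s

  bounded : ∀ {m n} → Sq I (m , n) → colour m n < k
  bounded s = let i , colour≡i , _ = colour-rectangle s in subst (_< k) (sym colour≡i) (toℕ<n i)

  proper : ∀ {m n p} → Sq I (m , n) → Sq I (n , p) → colour m n ≢ colour n p
  proper s t e with colour-rectangle s | colour-rectangle t
  ... | i , colour≡i , _ , n∈Bᵢ | j , colour≡j , n∈Aⱼ , _ =
    disjoint j _ n∈Aⱼ (subst (λ r → B r _) (toℕ-injective (trans (sym colour≡i) (trans e colour≡j))) n∈Bᵢ)

length≤2^covers : ∀ I → Unique I → ∀ {k} → Covers (Sq I) k → length I ≤ 2 ^ k
length≤2^covers I unique {k} cover =
  let c , χ = covers⇒shiftColouring cover in length≤2^colours k I unique c χ

Straddles : Pred ℕ 0ℓ → Pairs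
Straddles Z (m , n) = (Z m × ∁ Z n) ⊎ (∁ Z m × Z n)

straddles-covers : ∀ Z → Covers (Straddles Z) 2
straddles-covers Z = A , B , disjoint , covered
  where
  A B : Fin 2 → Pred ℕ 0ℓ
  A Fin.zero = Z
  A (Fin.suc _) = ∁ Z
  B Fin.zero = ∁ Z
  B (Fin.suc _) = Z

  disjoint : ∀ i n → A i n → B i n → ⊥
  disjoint Fin.zero n z ¬z = ¬z z
  disjoint (Fin.suc _) n ¬z z = ¬z z

  covered : ∀ m n → Straddles Z (m , n) → ∃ λ i → A i m × B i n
  covered m n (inj₁ (zm , ¬zn)) = Fin.zero , zm , ¬zn
  covered m n (inj₂ (¬zm , zn)) = Fin.suc Fin.zero , ¬zm , zn

⊆-split : ∀ {I Z X} → All (λ n → Dec (Z n)) I → X ⊆P Sq I →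
          X ⊆P ((SqP Z ∩ X) ∪ ((SqP (Diff I Z) ∩ X) ∪ Straddles Z))
⊆-split Z? X⊆Sq (m , n) x with X⊆Sq (m , n) x
... | m∈I , n∈I , m≢n with All.lookup Z? m∈I | All.lookup Z? n∈I
... | yes zm | yes zn = inj₁ ((zm , zn , m≢n) , x)
... | no ¬zm | no ¬zn = inj₂ (inj₁ (((m∈I , ¬zm) , (n∈I , ¬zn) , m≢n) , x))
... | yes zm | no ¬zn = inj₂ (inj₂ (inj₁ (zm , ¬zn)))
... | no ¬zm | yes zn = inj₂ (inj₂ (inj₂ (¬zm , zn)))

¬¬-decidableOn : ∀ {a ℓ} {A : Set a} (P : Pred A ℓ) xs → ¬ ¬ All (λ x → Dec (P x)) xs
¬¬-decidableOn P [] = λ ¬all → ¬all []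
¬¬-decidableOn P (x ∷ xs) ¬all =
  ¬¬-excluded-middle λ Px? → ¬¬-decidableOn P xs λ rest → ¬all (Px? ∷ rest)

¬¬-covers-split : ∀ {I Z X a b} → X ⊆P Sq I →
                  Covers (SqP Z ∩ X) a → Covers (SqP (Diff I Z) ∩ X) b →
                  ¬ ¬ Covers X (a + (b + 2))
¬¬-covers-split {I} {Z} X⊆Sq inside outside =
  ¬¬-map (λ Z? → covers-∪ (⊆-split Z? X⊆Sq) inside
                   (covers-∪ (λ _ x → x) outside (straddles-covers Z)))
         (¬¬-decidableOn Z I)

n+[n+2]≡2n+2 : ∀ n → n + (n + 2) ≡ 2 * n + 2
n+[n+2]≡2n+2 = solve-∀

x≤a+b+2⇒x≤2a+2⊎x≤2b+2 : ∀ {x} a b → x ≤ a + (b + 2) → x ≤ 2 * a + 2 ⊎ x ≤ 2 * b + 2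
x≤a+b+2⇒x≤2a+2⊎x≤2b+2 a b x≤ with ≤-total a b
... | inj₁ a≤b = inj₂ (≤-trans x≤ (≤-trans (+-monoˡ-≤ (b + 2) a≤b) (≤-reflexive (n+[n+2]≡2n+2 b))))
... | inj₂ b≤a = inj₁ (≤-trans x≤ (≤-trans (+-monoʳ-≤ a (+-monoˡ-≤ 2 b≤a)) (≤-reflexive (n+[n+2]≡2n+2 a))))

lemma3p1 :
  -- (1) ‖[I]^2‖_I → ∞ as |I| → ∞
  (∀ (m : ℕ) → ∃ λ (N : ℕ) → ∀ (I : List ℕ) → Unique I → N ≤ length I →
     ∀ (k : ℕ) → NormIs I (Sq I) k → m ≤ k)
  ×
  -- (2) subadditivity
  (∀ (I : List ℕ) (X Y : Pairs) → X ⊆P Sq I → Y ⊆P Sq I →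
     ∀ (a b c : ℕ) → NormIs I X a → NormIs I Y b → NormIs I (X ∪ Y) c →
     c ≤ a + b)
  ×
  -- (3) splitting; c ≥ x/2 - 1 is written as x ≤ 2*c + 2
  (∀ (I : List ℕ) (Z : Pred ℕ 0ℓ) (X : Pairs) →
     (∀ n → Z n → n ∈ I) → X ⊆P Sq I →
     ∀ (x a b : ℕ) → NormIs I X x → 2 < x →
     NormIs I (SqP Z ∩ X) a → NormIs I (SqP (Diff I Z) ∩ X) b →
     (x ≤ 2 * a + 2) ⊎ (x ≤ 2 * b + 2))
lemma3p1 =
  (λ m → 2 ^ m , λ I unique 2^m≤|I| k (cover , _) →
     ^-cancelʳ-≤ 2 (s≤s (s≤s z≤n)) (≤-trans 2^m≤|I| (length≤2^covers I unique cover))) ,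
  (λ I X Y _ _ a b c (X-cover , _) (Y-cover , _) (_ , c-least) →
     c-least (a + b) (covers-∪ (λ _ x → x) X-cover Y-cover)) ,
  (λ I Z X _ X⊆Sq x a b (_ , x-least) _ (inside , _) (outside , _) →
     x≤a+b+2⇒x≤2a+2⊎x≤2b+2 a b (decidable-stable (x ≤? _)
       (¬¬-map (x-least _) (¬¬-covers-split X⊆Sq inside outside))))
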